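{- Let $\mathcal G$ be a connected simple graph on the vertex set $n=\{0,1,\ldots,n-1\}$ with $n\ge 4$, and suppose $\mathcal G$ has two adjacent vertices $x$ and $y$ each of degree $2$. Then $\mathcal G$ is not perm-complete.
   Context: Permutations in $\mathrm{Sym}(n)$ compose left to right. For a finite sequence $\mathbf s$ in $\mathrm{Sym}(n)$, $\bigcirc\mathbf s$ is the composite of its terms in order, $\mathrm{Seq}(\mathbf s)$ the set of its rearrangements and $\mathrm{Prod}(\mathbf s)=\{\bigcirc\mathbf r:\mathbf r\in\mathrm{Seq}(\mathbf s)\}$; $\mathbf s$ is perm-complete iff $\mathrm{Prod}(\mathbf s)$ is $\mathrm{Alt}(n)$ or $\mathrm{Sym}(n)\setminus\mathrm{Alt}(n)$. A simple graph on vertex set $n$ is perm-complete iff it is isomorphic to the graph whose edges are the terms of some perm-complete sequence of pairwise distinct transpositions in $\mathrm{Sym}(n)$ (an edge $(x\,y)$ corresponding to the transposition $(x\,y)$). -}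

module Defs where

open import Data.Nat using (ℕ; zero; suc; _+_)
open import Data.Nat.Divisibility using (_∣_)
open import Data.Bool using (Bool; true; false; if_then_else_)
open import Data.Fin using (Fin)
open import Data.Fin.Permutation using (Permutation′; _⟨$⟩ʳ_; _∘ₚ_; id; transpose; _≈_)
open import Data.List using (List; []; _∷_; foldr; length; map; allFin)
open import Data.Nat.ListAction using (sum)
open import Data.List.Membership.Propositional using (_∈_)
open import Data.List.Relation.Binary.Permutation.Propositional using (_↭_)
open import Data.List.Relation.Unary.All using (All)
open import Data.List.Relation.Unary.AllPairs using (AllPairs)
open import Data.Product using (Σ; ∃; _×_; _,_)
open import Data.Sum using (_⊎_)
open import Relation.Binary.PropositionalEquality using (_≡_; _≢_)
open import Relation.Binary.Construct.Closure.ReflexiveTransitive using (Star)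
open import Relation.Nullary using (¬_)
open import Function.Bundles using (_⇔_)

-- Sym(n) is Permutation′ n; equality of permutations is pointwise (_≈_).
-- Composition _∘ₚ_ is left to right: (π ∘ₚ ρ) applies π first, then ρ.

○ : ∀ {n} → List (Permutation′ n) → Permutation′ n
○ = foldr _∘ₚ_ id

IsTransposition : ∀ {n} → Permutation′ n → Set
IsTransposition {n} t = Σ (Fin n) λ x → Σ (Fin n) λ y → x ≢ y × t ≈ transpose x y

InAlt : ∀ {n} → Permutation′ n → Set
InAlt {n} π = Σ (List (Permutation′ n)) λ ts →
  All IsTransposition ts × 2 ∣ length ts × ○ ts ≈ π

InSymMinusAlt : ∀ {n} → Permutation′ n → Set
InSymMinusAlt π = ¬ InAlt π

InProd : ∀ {n} → List (Permutation′ n) → Permutation′ n → Set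
InProd {n} s π = Σ (List (Permutation′ n)) λ r → r ↭ s × ○ r ≈ π

PermCompleteSeq : ∀ {n} → List (Permutation′ n) → Set
PermCompleteSeq {n} s =
  ((π : Permutation′ n) → InProd s π ⇔ InAlt π)
  ⊎ ((π : Permutation′ n) → InProd s π ⇔ InSymMinusAlt π)

record SimpleGraph (n : ℕ) : Set where
  field
    adj   : Fin n → Fin n → Bool
    sym   : ∀ x y → adj x y ≡ adj y x
    irrfl : ∀ x → adj x x ≡ false
open SimpleGraph public

Adjacent : ∀ {n} → SimpleGraph n → Fin n → Fin n → Set
Adjacent G x y = adj G x y ≡ true

degree : ∀ {n} → SimpleGraph n → Fin n → ℕ
degree {n} G x = sum (map (λ y → if adj G x y then 1 else 0) (allFin n))

Connected : ∀ {n} → SimpleGraph n → Set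
Connected {n} G = (u v : Fin n) → Star (Adjacent G) u v

EdgeOf : ∀ {n} → List (Permutation′ n) → Fin n → Fin n → Set
EdgeOf s x y = x ≢ y × Σ _ λ t → t ∈ s × t ≈ transpose x y

PermCompleteGraph : ∀ {n} → SimpleGraph n → Set
PermCompleteGraph {n} G =
  Σ (List (Permutation′ n)) λ s →
    All IsTransposition s
    × AllPairs (λ t u → ¬ (t ≈ u)) s
    × PermCompleteSeq s
    × Σ (Permutation′ n) λ f →
        (x y : Fin n) → Adjacent G x y ⇔ EdgeOf s (f ⟨$⟩ʳ x) (f ⟨$⟩ʳ y)

module Submission where

-- Let G be isomorphic to the edge graph of a sequence s of pairwise distinct
-- transpositions, with x ↦ x′, y ↦ y′ and the remaining neighbours a ↦ a′ of x
-- and b ↦ b′ of y. Then every term of s is (x′ a′), (x′ y′), (y′ b′), or fixes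
-- x′ and y′, and (x′ y′) occurs exactly once. Following where the two points
-- starting at x′ and y′ can be (at x′, at y′, or elsewhere) through any
-- rearrangement, a finite check shows that they cannot both return home: no
-- element of Prod(s) fixes x′ and y′. But Prod(s) of a perm-complete sequence
-- contains the identity (if it is Alt(n)) or, for n ≥ 4, a transposition
-- disjoint from {x′, y′} (if it is Sym(n) \ Alt(n)).

open import Defs hiding (sym)
open import Data.Nat using (ℕ; zero; suc; _≤_; s≤s)
open import Data.Nat.Divisibility using (_∣_; divides; ∣m∣n⇒∣m+n; ∣-refl)
open import Data.Nat.Properties using (+-suc)
open import Data.Nat.ListAction using (sum)
open import Data.Bool using (Bool; true; false; T; not; _∧_; _∨_; if_then_else_)
import Data.Bool as Bool
open import Data.Bool.ListAction using (all)
open import Data.Bool.Properties using (T-∧; T-∨)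
open import Data.Empty using (⊥)
open import Data.Fin using (Fin; _≟_; punchIn; punchOut) renaming (zero to fzero; suc to fsuc)
open import Data.Fin.Properties using (punchInᵢ≢i; punchIn-injective; punchIn-punchOut)
open import Data.Fin.Permutation
  using (Permutation′; _⟨$⟩ʳ_; _⟨$⟩ˡ_; id; transpose; _≈_; inverseʳ)
import Data.Fin.Permutation.Components as PC
open import Data.List using (List; []; _∷_; _++_; length; map; filter; allFin)
open import Data.List.Properties using (length-++)
open import Data.List.Membership.Propositional using (_∈_)
open import Data.List.Membership.Propositional.Properties using (∈-filter⁺; ∈-filter⁻; ∈-allFin)
open import Data.List.Relation.Unary.All as All using (All; []; _∷_)
open import Data.List.Relation.Unary.All.Properties using (++⁺; all⁺)
open import Data.List.Relation.Unary.Any as Any using (Any; here; there)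
open import Data.List.Relation.Unary.AllPairs using (AllPairs; []; _∷_)
open import Data.List.Relation.Unary.Unique.Propositional using (Unique)
open import Data.List.Relation.Unary.Unique.Propositional.Properties using (filter⁺; allFin⁺)
open import Data.List.Relation.Binary.Permutation.Propositional using (_↭_; ↭-refl; ↭-sym; ↭⇒↭ₛ)
open import Data.List.Relation.Binary.Permutation.Propositional.Properties using (All-resp-↭; Any-resp-↭)
import Data.List.Relation.Binary.Permutation.Setoid.Properties as SetoidPermutation
open import Data.Product using (Σ; _×_; _,_; proj₁; proj₂)
open import Data.Sum using (_⊎_; inj₁; inj₂)
open import Function.Base using (_∘_)
open import Function.Bundles using (_⇔_; Equivalence; Injection)
open import Function.Properties.Inverse using (↔⇒↣)
open import Relation.Unary using (Decidable)
open import Relation.Binary.PropositionalEquality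
  using (_≡_; _≢_; refl; sym; trans; cong; subst; resp₂; setoid; module ≡-Reasoning)
open import Relation.Nullary using (¬_; Dec; yes; no; contradiction)
open import Relation.Nullary.Decidable using (dec-true; dec-false)

permute-injective : ∀ {n} (π : Permutation′ n) {p q : Fin n} → π ⟨$⟩ʳ p ≡ π ⟨$⟩ʳ q → p ≡ q
permute-injective π = Injection.injective (↔⇒↣ π)

transpose-at-fst : ∀ {n} (i j : Fin n) → transpose i j ⟨$⟩ʳ i ≡ j
transpose-at-fst i j rewrite dec-true (i ≟ i) refl = refl

transpose-at-snd : ∀ {n} (i j : Fin n) → transpose i j ⟨$⟩ʳ j ≡ i
transpose-at-snd i j with j ≟ i
... | yes j≡i = j≡i
... | no _ rewrite dec-true (j ≟ j) refl = refl

transpose-away : ∀ {n} (i j k : Fin n) → k ≢ i → k ≢ j → transpose i j ⟨$⟩ʳ k ≡ k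
transpose-away i j k k≢i k≢j rewrite dec-false (k ≟ i) k≢i | dec-false (k ≟ j) k≢j = refl

transpose-sym : ∀ {n} (i j : Fin n) → transpose i j ≈ transpose j i
transpose-sym i j k = by-cases (k ≟ i) (k ≟ j)
  where
  by-cases : Dec (k ≡ i) → Dec (k ≡ j) → transpose i j ⟨$⟩ʳ k ≡ transpose j i ⟨$⟩ʳ k
  by-cases (yes refl) _ = trans (transpose-at-fst k j) (sym (transpose-at-snd j k))
  by-cases (no _) (yes refl) = trans (transpose-at-snd i k) (sym (transpose-at-fst k i))
  by-cases (no k≢i) (no k≢j) =
    trans (transpose-away i j k k≢i k≢j) (sym (transpose-away j i k k≢j k≢i))

transpose-involutive : ∀ {n} (i j k : Fin n) → transpose i j ⟨$⟩ʳ (transpose i j ⟨$⟩ʳ k) ≡ k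
transpose-involutive i j k =
  trans (cong (transpose i j ⟨$⟩ʳ_) (transpose-sym i j k)) (PC.transpose-inverse i j)

○-++ : ∀ {n} (xs ys : List (Permutation′ n)) (i : Fin n) →
       ○ (xs ++ ys) ⟨$⟩ʳ i ≡ ○ ys ⟨$⟩ʳ (○ xs ⟨$⟩ʳ i)
○-++ []       ys i = refl
○-++ (t ∷ xs) ys i = ○-++ xs ys (t ⟨$⟩ʳ i)

id-in-Alt : ∀ {n} → InAlt (id {n})
id-in-Alt = [] , [] , divides 0 refl , λ _ → refl

even-or-odd : ∀ m → 2 ∣ m ⊎ 2 ∣ suc m
even-or-odd 0       = inj₁ (divides 0 refl)
even-or-odd (suc m) with even-or-odd m
... | inj₁ 2∣m  = inj₂ (∣m∣n⇒∣m+n {m = 2} ∣-refl 2∣m)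
... | inj₂ 2∣1+m = inj₁ 2∣1+m

-- If a product of transpositions is odd, then so is every transposition σ:
-- were σ = ○ ts with |ts| even, then s ++ σ ∷ ts would be an even-length
-- product of transpositions equal to ○ s (as σσ = 1).
transposition-outside-Alt : ∀ {n} (s : List (Permutation′ n)) → All IsTransposition s →
  ¬ InAlt (○ s) → ∀ σ → IsTransposition σ → ¬ InAlt σ
transposition-outside-Alt s s-trans ○s∉Alt σ σ-trans@(c , d , _ , σ≈cd) (ts , ts-trans , 2∣ts , ○ts≈σ) =
  ○s∉Alt (s ++ σ ∷ ts , ++⁺ s-trans (σ-trans ∷ ts-trans) , even-length , same-product)
  where
  odd-s : 2 ∣ suc (length s)
  odd-s with even-or-odd (length s)
  ... | inj₁ 2∣s   = contradiction (s , s-trans , 2∣s , λ _ → refl) ○s∉Alt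
  ... | inj₂ 2∣1+s = 2∣1+s

  even-length : 2 ∣ length (s ++ σ ∷ ts)
  even-length rewrite length-++ s {σ ∷ ts} | +-suc (length s) (length ts) =
    ∣m∣n⇒∣m+n odd-s 2∣ts

  same-product : ○ (s ++ σ ∷ ts) ≈ ○ s
  same-product i = begin
    ○ (s ++ σ ∷ ts) ⟨$⟩ʳ i             ≡⟨ ○-++ s (σ ∷ ts) i ⟩
    ○ ts ⟨$⟩ʳ (σ ⟨$⟩ʳ (○ s ⟨$⟩ʳ i))     ≡⟨ ○ts≈σ _ ⟩
    σ ⟨$⟩ʳ (σ ⟨$⟩ʳ (○ s ⟨$⟩ʳ i))        ≡⟨ trans (σ≈cd _) (cong (transpose c d ⟨$⟩ʳ_) (σ≈cd _)) ⟩
    transpose c d ⟨$⟩ʳ (transpose c d ⟨$⟩ʳ (○ s ⟨$⟩ʳ i)) ≡⟨ transpose-involutive c d _ ⟩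
    ○ s ⟨$⟩ʳ i                         ∎
    where open ≡-Reasoning

-- On at least four points, any two points u ≠ v are fixed by some transposition:
-- punching u and then v out of Fin (4 + m) leaves the points off j, j : Fin (2 + m).
transposition-fixing : ∀ {n} → 4 ≤ n → (u v : Fin n) → u ≢ v →
  Σ (Permutation′ n) λ σ → IsTransposition σ × σ ⟨$⟩ʳ u ≡ u × σ ⟨$⟩ʳ v ≡ v
transposition-fixing {suc (suc (suc (suc m)))} (s≤s (s≤s (s≤s (s≤s _)))) u v u≢v =
  transpose (off fzero) (off (fsuc fzero)) ,
  (off fzero , off (fsuc fzero) , off-injective (λ ()) , λ _ → refl) ,
  transpose-away _ _ u (off-≢u fzero ∘ sym) (off-≢u (fsuc fzero) ∘ sym) ,
  transpose-away _ _ v (off-≢v fzero ∘ sym) (off-≢v (fsuc fzero) ∘ sym)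
  where
  v′ : Fin (suc (suc (suc m)))
  v′ = punchOut u≢v
  off : Fin (suc (suc m)) → Fin (suc (suc (suc (suc m))))
  off j = punchIn u (punchIn v′ j)
  off-≢u : ∀ j → off j ≢ u
  off-≢u j = punchInᵢ≢i u (punchIn v′ j)
  off-≢v : ∀ j → off j ≢ v
  off-≢v j eq = punchInᵢ≢i v′ j (punchIn-injective u _ _ (trans eq (sym (punchIn-punchOut u≢v))))
  off-injective : ∀ {j k} → j ≢ k → off j ≢ off k
  off-injective j≢k eq = j≢k (punchIn-injective v′ _ _ (punchIn-injective u _ _ eq))

-- Prod(s) of a perm-complete sequence of transpositions contains a permutation
-- fixing any two prescribed points: the identity if Prod(s) = Alt(n), and
-- a transposition avoiding both points if Prod(s) = Sym(n) \ Alt(n).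
perm-complete-fixes-pair : ∀ {n} → 4 ≤ n → (s : List (Permutation′ n)) → All IsTransposition s →
  PermCompleteSeq s → (u v : Fin n) → u ≢ v →
  Σ (Permutation′ n) λ π → InProd s π × π ⟨$⟩ʳ u ≡ u × π ⟨$⟩ʳ v ≡ v
perm-complete-fixes-pair _ s _ (inj₁ Prod≡Alt) u v _ =
  id , Equivalence.from (Prod≡Alt id) id-in-Alt , refl , refl
perm-complete-fixes-pair 4≤n s s-trans (inj₂ Prod≡Odd) u v u≢v
  with transposition-fixing 4≤n u v u≢v
... | σ , σ-trans , σu , σv = σ , Equivalence.from (Prod≡Odd σ) σ-odd , σu , σv
  where
  ○s∉Alt : ¬ InAlt (○ s)
  ○s∉Alt = Equivalence.to (Prod≡Odd (○ s)) (s , ↭-refl , λ _ → refl)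
  σ-odd : ¬ InAlt σ
  σ-odd = transposition-outside-Alt s s-trans ○s∉Alt σ σ-trans

indicator-sum : ∀ {A : Set} (g : A → Bool) (xs : List A) →
  sum (map (λ z → if g z then 1 else 0) xs) ≡ length (filter (λ z → g z Bool.≟ true) xs)
indicator-sum g []       = refl
indicator-sum g (z ∷ xs) with g z
... | true  = cong suc (indicator-sum g xs)
... | false = indicator-sum g xs

partner-in-pair : ∀ {A : Set} {xs : List A} {y : A} → length xs ≡ 2 → Unique xs → y ∈ xs →
  Σ A λ a → a ≢ y × a ∈ xs × (∀ {z} → z ∈ xs → z ≡ y ⊎ z ≡ a)
partner-in-pair {xs = u ∷ v ∷ []} refl ((u≢v ∷ []) ∷ [] ∷ []) (here refl) =
  v , u≢v ∘ sym , there (here refl) , λ where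
    (here z≡u)         → inj₁ z≡u
    (there (here z≡v)) → inj₂ z≡v
partner-in-pair {xs = u ∷ v ∷ []} refl ((u≢v ∷ []) ∷ [] ∷ []) (there (here refl)) =
  u , u≢v , here refl , λ where
    (here z≡u)         → inj₂ z≡u
    (there (here z≡v)) → inj₁ z≡v

adjacent? : ∀ {n} (G : SimpleGraph n) (x : Fin n) → Decidable (Adjacent G x)
adjacent? G x z = adj G x z Bool.≟ true

neighbours : ∀ {n} → SimpleGraph n → Fin n → List (Fin n)
neighbours {n} G x = filter (adjacent? G x) (allFin n)

degree-neighbours : ∀ {n} (G : SimpleGraph n) (x : Fin n) → degree G x ≡ length (neighbours G x)
degree-neighbours {n} G x = indicator-sum (adj G x) (allFin n)

neighbours-unique : ∀ {n} (G : SimpleGraph n) (x : Fin n) → Unique (neighbours G x)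
neighbours-unique {n} G x = filter⁺ (adjacent? G x) (allFin⁺ n)

∈-neighbours : ∀ {n} (G : SimpleGraph n) {x z : Fin n} → Adjacent G x z → z ∈ neighbours G x
∈-neighbours G {x} {z} = ∈-filter⁺ (adjacent? G x) (∈-allFin z)

neighbours-adjacent : ∀ {n} (G : SimpleGraph n) {x z : Fin n} → z ∈ neighbours G x → Adjacent G x z
neighbours-adjacent {n} G {x} z∈N = proj₂ (∈-filter⁻ (adjacent? G x) {xs = allFin n} z∈N)

second-neighbour : ∀ {n} (G : SimpleGraph n) {x y : Fin n} → Adjacent G x y → degree G x ≡ 2 →
  Σ (Fin n) λ a → a ≢ y × Adjacent G x a × (∀ z → Adjacent G x z → z ≡ y ⊎ z ≡ a)
second-neighbour G {x} x~y deg-x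
  with partner-in-pair (trans (sym (degree-neighbours G x)) deg-x) (neighbours-unique G x) (∈-neighbours G x~y)
... | a , a≢y , a∈N , only =
  a , a≢y , neighbours-adjacent G a∈N , λ z x~z → only (∈-neighbours G x~z)

adjacent-sym : ∀ {n} (G : SimpleGraph n) {x y : Fin n} → Adjacent G x y → Adjacent G y x
adjacent-sym G {x} {y} x~y = trans (SimpleGraph.sym G y x) x~y

Distinct : ∀ {n} → List (Permutation′ n) → Set
Distinct = AllPairs (λ t u → ¬ t ≈ u)

Distinct-resp-↭ : ∀ {n} {r s : List (Permutation′ n)} → r ↭ s → Distinct r → Distinct s
Distinct-resp-↭ r↭s =
  SetoidPermutation.AllPairs-resp-↭ (setoid _) (λ t≉u u≈t → t≉u (λ i → sym (u≈t i)))
    (resp₂ _) (↭⇒↭ₛ r↭s)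

-- A tracked point sits at x, at y, or elsewhere (O). Besides
-- permutations fixing x and y, the terms can be the special transpositions
-- A = (x a), E = (x y), B = (y b), each used at most once.
data Place : Set where
  X Y O : Place

data Special : Set where
  A E B : Special

specials : List Special
specials = A ∷ E ∷ B ∷ []

∈-specials : ∀ k → k ∈ specials
∈-specials A = here refl
∈-specials E = there (here refl)
∈-specials B = there (there (here refl))

_≟ₛ_ : (k k′ : Special) → Dec (k ≡ k′)
A ≟ₛ A = yes refl
A ≟ₛ E = no λ ()
A ≟ₛ B = no λ ()
E ≟ₛ A = no λ ()
E ≟ₛ E = yes refl
E ≟ₛ B = no λ ()
B ≟ₛ A = no λ ()
B ≟ₛ E = no λ ()
B ≟ₛ B = yes refl

-- The places a point at place c may reach under special k: under (x a) a point
-- elsewhere reaches x exactly when it is a, and similarly for (y b).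
moves : Special → Place → List Place
moves A X = O ∷ []
moves A Y = Y ∷ []
moves A O = O ∷ X ∷ []
moves E X = Y ∷ []
moves E Y = X ∷ []
moves E O = O ∷ []
moves B X = X ∷ []
moves B Y = O ∷ []
moves B O = O ∷ Y ∷ []

-- A budget records which specials may still occur (true) or are used up (false).
Budget : Set
Budget = Special → Bool

use : Special → Budget → Budget
use k β k′ with k ≟ₛ k′
... | yes _ = false
... | no  _ = β k′

use-false : ∀ k β k′ → use k β k′ ≡ false → k ≡ k′ ⊎ β k′ ≡ false
use-false k β k′ eq with k ≟ₛ k′
... | yes k≡k′ = inj₁ k≡k′
... | no  _    = inj₂ eq

use-true : ∀ k β k′ → use k β k′ ≡ true → k ≢ k′ × β k′ ≡ true
use-true k β k′ eq with k ≟ₛ k′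
... | no  k≢k′ = k≢k′ , eq

-- A run may stop at places (c, d) unless E is used up and (c, d) = (X, Y).
-- While E is still available the run cannot stop, since E still occurs.
may-stop : Bool → Place → Place → Bool
may-stop false X Y = false
may-stop _     _ _ = true

-- `safe m β c d`: every run of further specials within budget β, starting at
-- places (c, d), stops only where allowed; the fuel m bounds the number of
-- available specials (at fuel 0 none may be left).
safe : ℕ → Budget → Place → Place → Bool

after : ℕ → Budget → Special → Place → Place → Bool
after m β k c d = all (λ c′ → all (λ d′ → safe m (use k β) c′ d′) (moves k d)) (moves k c)

safe zero    β c d = may-stop (β E) c d ∧ all (not ∘ β) specials
safe (suc m) β c d = may-stop (β E) c d ∧ all (λ k → not (β k) ∨ after m β k c d) specials

-- The finite check at the heart of the proof: two points starting at x and y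
-- cannot both return home once E has been used.
safe-start : T (safe 3 (λ _ → true) X Y)
safe-start = _

all-∈ : ∀ {A : Set} (f : A → Bool) (xs : List A) {z} → T (all f xs) → z ∈ xs → T (f z)
all-∈ f xs h = All.lookup (all⁺ f xs h)

safe-stop : ∀ m β c d → T (safe m β c d) → T (may-stop (β E) c d)
safe-stop zero    β c d h = proj₁ (Equivalence.to (T-∧ {may-stop (β E) c d}) h)
safe-stop (suc m) β c d h = proj₁ (Equivalence.to (T-∧ {may-stop (β E) c d}) h)

safe-exhausted : ∀ β c d k → T (safe zero β c d) → β k ≡ true → ⊥
safe-exhausted β c d k h βk≡true =
  subst (T ∘ not) βk≡true (all-∈ (not ∘ β) specials (proj₂ (Equivalence.to (T-∧ {may-stop (β E) c d}) h)) (∈-specials k))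

safe-step : ∀ m β c d k {c′ d′} → T (safe (suc m) β c d) → β k ≡ true →
  c′ ∈ moves k c → d′ ∈ moves k d → T (safe m (use k β) c′ d′)
safe-step m β c d k {c′} h βk≡true c′∈ d′∈
  with Equivalence.to (T-∨ {not (β k)}) (all-∈ (λ k → not (β k) ∨ after m β k c d) specials
         (proj₂ (Equivalence.to (T-∧ {may-stop (β E) c d}) h)) (∈-specials k))
... | inj₁ not-βk = contradiction (subst (T ∘ not) βk≡true not-βk) λ ()
... | inj₂ next   =
  all-∈ (λ d′ → safe m (use k β) c′ d′) (moves k d)
    (all-∈ (λ c′ → all (λ d′ → safe m (use k β) c′ d′) (moves k d)) (moves k c) next c′∈) d′∈

module Configuration {n : ℕ} (x y a b : Fin n) where

  special : Special → Permutation′ n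
  special A = transpose x a
  special E = transpose x y
  special B = transpose y b

  Fixes : Permutation′ n → Set
  Fixes t = t ⟨$⟩ʳ x ≡ x × t ⟨$⟩ʳ y ≡ y

  -- The terms that may occur when x and y have no neighbours besides y, a and x, b.
  Tame : Permutation′ n → Set
  Tame t = Fixes t ⊎ Σ Special λ k → t ≈ special k

  module Tracking (x≢y : x ≢ y) (a≢x : a ≢ x) (a≢y : a ≢ y) (b≢x : b ≢ x) (b≢y : b ≢ y) where

    At : Place → Fin n → Set
    At X p = p ≡ x
    At Y p = p ≡ y
    At O p = p ≢ x × p ≢ y

    fixes-keep-place : ∀ {t} → Fixes t → ∀ c {p} → At c p → At c (t ⟨$⟩ʳ p)
    fixes-keep-place (tx , ty) X refl = tx
    fixes-keep-place (tx , ty) Y refl = ty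
    fixes-keep-place {t} (tx , ty) O (p≢x , p≢y) =
      (λ tp≡x → p≢x (permute-injective t (trans tp≡x (sym tx)))) ,
      (λ tp≡y → p≢y (permute-injective t (trans tp≡y (sym ty))))

    -- `moves` over-approximates the effect of the specials.
    special-moves : ∀ k c {p} → At c p → Σ Place λ c′ → c′ ∈ moves k c × At c′ (special k ⟨$⟩ʳ p)
    special-moves A X refl = O , here refl , subst (λ q → At O q) (sym (transpose-at-fst x a)) (a≢x , a≢y)
    special-moves A Y refl = Y , here refl , transpose-away x a y (x≢y ∘ sym) (a≢y ∘ sym)
    special-moves A O {p} (p≢x , p≢y) with p ≟ a
    ... | yes refl = X , there (here refl) , transpose-at-snd x a
    ... | no p≢a   = O , here refl , subst (λ q → At O q) (sym (transpose-away x a p p≢x p≢a)) (p≢x , p≢y)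
    special-moves E X refl = Y , here refl , transpose-at-fst x y
    special-moves E Y refl = X , here refl , transpose-at-snd x y
    special-moves E O {p} (p≢x , p≢y) =
      O , here refl , subst (λ q → At O q) (sym (transpose-away x y p p≢x p≢y)) (p≢x , p≢y)
    special-moves B X refl = X , here refl , transpose-away y b x x≢y (b≢x ∘ sym)
    special-moves B Y refl = O , here refl , subst (λ q → At O q) (sym (transpose-at-fst y b)) (b≢x , b≢y)
    special-moves B O {p} (p≢x , p≢y) with p ≟ b
    ... | yes refl = Y , there (here refl) , transpose-at-snd y b
    ... | no p≢b   = O , here refl , subst (λ q → At O q) (sym (transpose-away y b p p≢y p≢b)) (p≢x , p≢y)

    -- Images of x and y under the specials; they show that the three specials
    -- are distinct and that none of them fixes both x and y.
    image-x image-y : Special → Fin n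
    image-x A = a
    image-x E = y
    image-x B = x
    image-y A = y
    image-y E = x
    image-y B = b

    special-at-x : ∀ k → special k ⟨$⟩ʳ x ≡ image-x k
    special-at-x A = transpose-at-fst x a
    special-at-x E = transpose-at-fst x y
    special-at-x B = transpose-away y b x x≢y (b≢x ∘ sym)

    special-at-y : ∀ k → special k ⟨$⟩ʳ y ≡ image-y k
    special-at-y A = transpose-away x a y (x≢y ∘ sym) (a≢y ∘ sym)
    special-at-y E = transpose-at-snd x y
    special-at-y B = transpose-at-fst y b

    same-image-x : ∀ k k′ → special k ≈ special k′ → image-x k ≡ image-x k′
    same-image-x k k′ eq = trans (sym (special-at-x k)) (trans (eq x) (special-at-x k′))

    same-image-y : ∀ k k′ → special k ≈ special k′ → image-y k ≡ image-y k′
    same-image-y k k′ eq = trans (sym (special-at-y k)) (trans (eq y) (special-at-y k′))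

    special-injective : ∀ {k k′} → special k ≈ special k′ → k ≡ k′
    special-injective {A} {A} _ = refl
    special-injective {E} {E} _ = refl
    special-injective {B} {B} _ = refl
    special-injective {A} {E} eq = contradiction (same-image-x A E eq) a≢y
    special-injective {E} {A} eq = contradiction (sym (same-image-x E A eq)) a≢y
    special-injective {A} {B} eq = contradiction (same-image-x A B eq) a≢x
    special-injective {B} {A} eq = contradiction (sym (same-image-x B A eq)) a≢x
    special-injective {E} {B} eq = contradiction (sym (same-image-y E B eq)) b≢x
    special-injective {B} {E} eq = contradiction (same-image-y B E eq) b≢x

    fixes-not-special : ∀ {t} k → Fixes t → ¬ t ≈ special k
    fixes-not-special A (tx , _) t≈ = a≢x (trans (sym (special-at-x A)) (trans (sym (t≈ x)) tx))
    fixes-not-special E (tx , _) t≈ = x≢y (trans (sym tx) (trans (t≈ x) (special-at-x E)))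
    fixes-not-special B (_ , ty) t≈ = b≢y (trans (sym (special-at-y B)) (trans (sym (t≈ y)) ty))

    Faithful : Budget → List (Permutation′ n) → Set
    Faithful β r = (∀ k → β k ≡ false → All (λ u → ¬ u ≈ special k) r)
                 × (β E ≡ true → Any (λ u → u ≈ special E) r)

    available : ∀ {β t r} k → t ≈ special k → Faithful β (t ∷ r) → β k ≡ true
    available {β} k t≈k (absent , _) with β k in βk
    ... | true  = refl
    ... | false = contradiction t≈k (All.head (absent k βk))

    faithful-skip : ∀ {β t r} → ¬ t ≈ special E → Faithful β (t ∷ r) → Faithful β r
    faithful-skip t≉E (absent , present) =
      (λ k βk → All.tail (absent k βk)) , λ βE → Any.tail t≉E (present βE)

    -- Passing the special k uses it up; distinctness of the terms guarantees
    -- that k does not occur again.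
    faithful-use : ∀ {β t r} k → t ≈ special k → All (λ u → ¬ t ≈ u) r →
                   Faithful β (t ∷ r) → Faithful (use k β) r
    faithful-use {β} {t} {r} k t≈k t≉r (absent , present) = absent′ , present′
      where
      absent′ : ∀ k′ → use k β k′ ≡ false → All (λ u → ¬ u ≈ special k′) r
      absent′ k′ used with use-false k β k′ used
      ... | inj₁ refl = All.map (λ t≉u u≈k → t≉u (λ i → trans (t≈k i) (sym (u≈k i)))) t≉r
      ... | inj₂ βk′  = All.tail (absent k′ βk′)
      present′ : use k β E ≡ true → Any (λ u → u ≈ special E) r
      present′ avail with use-true k β E avail
      ... | k≢E , βE =
        Any.tail (λ t≈E → k≢E (special-injective (λ i → trans (sym (t≈k i)) (t≈E i)))) (present βE)

    stop-away : ∀ c d → T (may-stop false c d) → At c x → At d y → ⊥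
    stop-away X X _ _    y≡x       = x≢y (sym y≡x)
    stop-away X O _ _    (_ , y≢y) = y≢y refl
    stop-away Y _ _ x≡y  _         = x≢y x≡y
    stop-away O _ _ (x≢x , _) _    = x≢x refl

    -- Soundness of the abstract check: if p, q sit at places c, d and the check
    -- succeeds from (c, d), then no sequence r of pairwise distinct tame terms,
    -- faithful to the budget, carries p to x and q to y.
    track : ∀ m β r {c d p q} → At c p → At d q → T (safe m β c d) →
            All Tame r → Distinct r → Faithful β r → ¬ (○ r ⟨$⟩ʳ p ≡ x × ○ r ⟨$⟩ʳ q ≡ y)
    track m β [] {c} {d} cp dq ok _ _ (_ , present) (refl , refl) with β E in βE
    ... | true  = contradiction (present refl) λ ()
    ... | false = stop-away c d (subst (λ e → T (may-stop e c d)) βE (safe-stop m β c d ok)) cp dq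
    track m β (t ∷ r) {c} {d} cp dq ok (inj₁ t-fixes ∷ tame) (_ ∷ distinct) faithful =
      track m β r (fixes-keep-place {t} t-fixes c cp) (fixes-keep-place {t} t-fixes d dq) ok tame distinct
        (faithful-skip {β} {t} (fixes-not-special {t} E t-fixes) faithful)
    track zero β (t ∷ r) {c} {d} _ _ ok (inj₂ (k , t≈k) ∷ _) _ faithful =
      λ _ → safe-exhausted β c d k ok (available k t≈k faithful)
    track (suc m) β (t ∷ r) {c} {d} {p} {q} cp dq ok (inj₂ (k , t≈k) ∷ tame) (t≉r ∷ distinct) faithful
      with special-moves k c cp | special-moves k d dq
    ... | c′ , c′∈ , c′p | d′ , d′∈ , d′q =
      track m (use k β) r (subst (At c′) (sym (t≈k p)) c′p) (subst (At d′) (sym (t≈k q)) d′q)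
        (safe-step m β c d k ok (available k t≈k faithful) c′∈ d′∈) tame distinct
        (faithful-use k t≈k t≉r faithful)

    no-product-fixes : (s : List (Permutation′ n)) → All Tame s → Distinct s →
      Any (λ u → u ≈ special E) s → ∀ {π} → InProd s π → ¬ Fixes π
    no-product-fixes s tame distinct has-E (r , r↭s , ○r≈π) (πx , πy) =
      track 3 (λ _ → true) r {X} {Y} refl refl safe-start
        (All-resp-↭ s↭r tame) (Distinct-resp-↭ s↭r distinct) ((λ _ ()) , λ _ → Any-resp-↭ s↭r has-E)
        (trans (○r≈π x) πx , trans (○r≈π y) πy)
      where s↭r = ↭-sym r↭s

edge-sym : ∀ {n} {s : List (Permutation′ n)} {u v} → EdgeOf s u v → EdgeOf s v u
edge-sym {u = u} {v} (u≢v , t , t∈s , t≈uv) = u≢v ∘ sym , t , t∈s , λ i → trans (t≈uv i) (transpose-sym u v i)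

edge-occurs : ∀ {n} {s : List (Permutation′ n)} {u v} → EdgeOf s u v → Any (λ t → t ≈ transpose u v) s
edge-occurs {u = u} {v} (_ , t , t∈s , t≈uv) = Any.map (λ t≡w → subst (λ w → w ≈ transpose u v) t≡w t≈uv) t∈s

module EdgeClassification {n} (s : List (Permutation′ n)) (x y a b : Fin n)
    (x-edges : ∀ v → EdgeOf s x v → v ≡ y ⊎ v ≡ a)
    (y-edges : ∀ v → EdgeOf s y v → v ≡ x ⊎ v ≡ b) where

  open Configuration x y a b

  tame-at-x : ∀ {t} v → t ≈ transpose x v → EdgeOf s x v → Tame t
  tame-at-x v t≈xv e with x-edges v e
  ... | inj₁ refl = inj₂ (E , t≈xv)
  ... | inj₂ refl = inj₂ (A , t≈xv)

  tame-at-y : ∀ {t} v → t ≈ transpose y v → EdgeOf s y v → Tame t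
  tame-at-y v t≈yv e with y-edges v e
  ... | inj₁ refl = inj₂ (E , λ i → trans (t≈yv i) (transpose-sym y x i))
  ... | inj₂ refl = inj₂ (B , t≈yv)

  tame-edge : ∀ {t} u v → t ≈ transpose u v → EdgeOf s u v → Tame t
  tame-edge {t} u v t≈uv e = by-cases (u ≟ x) (v ≟ x) (u ≟ y) (v ≟ y)
    where
    t≈vu : t ≈ transpose v u
    t≈vu i = trans (t≈uv i) (transpose-sym u v i)
    by-cases : Dec (u ≡ x) → Dec (v ≡ x) → Dec (u ≡ y) → Dec (v ≡ y) → Tame t
    by-cases (yes refl) _ _ _ = tame-at-x {t} v t≈uv e
    by-cases (no _) (yes refl) _ _ = tame-at-x {t} u t≈vu (edge-sym {s = s} e)
    by-cases (no _) (no _) (yes refl) _ = tame-at-y {t} v t≈uv e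
    by-cases (no _) (no _) (no _) (yes refl) = tame-at-y {t} u t≈vu (edge-sym {s = s} e)
    by-cases (no u≢x) (no v≢x) (no u≢y) (no v≢y) = inj₁
      ( trans (t≈uv x) (transpose-away u v x (u≢x ∘ sym) (v≢x ∘ sym))
      , trans (t≈uv y) (transpose-away u v y (u≢y ∘ sym) (v≢y ∘ sym)))

  tame-term : ∀ {t} → t ∈ s → IsTransposition t → Tame t
  tame-term {t} t∈s (u , v , u≢v , t≈uv) = tame-edge {t} u v t≈uv (u≢v , t , t∈s , t≈uv)

  all-tame : All IsTransposition s → All Tame s
  all-tame s-trans = All.tabulate λ t∈s → tame-term t∈s (All.lookup s-trans t∈s)

module Isomorphism {n} (G : SimpleGraph n) (s : List (Permutation′ n)) (f : Permutation′ n)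
    (iso : (x y : Fin n) → Adjacent G x y ⇔ EdgeOf s (f ⟨$⟩ʳ x) (f ⟨$⟩ʳ y)) where

  edge : ∀ {x y} → Adjacent G x y → EdgeOf s (f ⟨$⟩ʳ x) (f ⟨$⟩ʳ y)
  edge {x} {y} = Equivalence.to (iso x y)

  edge-neighbours : ∀ {x y a} → (∀ z → Adjacent G x z → z ≡ y ⊎ z ≡ a) →
    ∀ v → EdgeOf s (f ⟨$⟩ʳ x) v → v ≡ f ⟨$⟩ʳ y ⊎ v ≡ f ⟨$⟩ʳ a
  edge-neighbours {x} only v e
    with only (f ⟨$⟩ˡ v) (Equivalence.from (iso x (f ⟨$⟩ˡ v)) (subst (EdgeOf s (f ⟨$⟩ʳ x)) (sym (inverseʳ f)) e))
  ... | inj₁ refl = inj₁ (sym (inverseʳ f))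
  ... | inj₂ refl = inj₂ (sym (inverseʳ f))

theorem2p3 : (n : ℕ) → 4 ≤ n → (G : SimpleGraph n) → Connected G →
    (x y : Fin n) → Adjacent G x y → degree G x ≡ 2 → degree G y ≡ 2 →
    ¬ PermCompleteGraph G
theorem2p3 n 4≤n G _ x y x~y deg-x deg-y (s , s-trans , s-distinct , s-complete , f , iso) =
  let open Isomorphism G s f iso
      a , a≢y , x~a , x-only = second-neighbour G x~y deg-x
      b , b≢x , y~b , y-only = second-neighbour G (adjacent-sym G x~y) deg-y
      open Configuration (f ⟨$⟩ʳ x) (f ⟨$⟩ʳ y) (f ⟨$⟩ʳ a) (f ⟨$⟩ʳ b)
      open Tracking (proj₁ (edge x~y)) (proj₁ (edge x~a) ∘ sym) (a≢y ∘ permute-injective f)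
                    (b≢x ∘ permute-injective f) (proj₁ (edge y~b) ∘ sym)
      tame : All Tame s
      tame = EdgeClassification.all-tame s _ _ _ _ (edge-neighbours x-only) (edge-neighbours y-only) s-trans
      π , π∈Prod , π-fixes =
        perm-complete-fixes-pair 4≤n s s-trans s-complete (f ⟨$⟩ʳ x) (f ⟨$⟩ʳ y) (proj₁ (edge x~y))
  in no-product-fixes s tame s-distinct (edge-occurs (edge x~y)) {π} π∈Prod π-fixes
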